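{- For every finite simple connected graph $G$, $\mathsf{in}_m(G)=\mathsf{pw}(G)+1$, where $\mathsf{pw}(G)$ is the pathwidth of $G$.
   Context: For $S\subseteq V(G)$, $\partial_G(S)$ is the set of vertices of $S$ having a neighbor in $V(G)\setminus S$. A $k$-search of length $\ell$ on $G$ is a sequence $(S_t)_{t=1}^{\ell}$ of subsets of $V(G)$ with $|S_t|\le k$. Define $\mathsf{FC}_0=\varnothing$, $\mathsf{PC}_{t+1}=\mathsf{FC}_t\cup S_{t+1}$, $\mathsf{FC}_{t+1}=\mathsf{PC}_{t+1}\setminus\partial_G(\mathsf{PC}_{t+1})$. The search is successful if $\mathsf{FC}_\ell=V(G)$, and monotonic if $\mathsf{FC}_i\subseteq\mathsf{FC}_j$ whenever $i\le j$. $\mathsf{in}_m(G)$ is the least $k$ such that a successful monotonic $k$-search on $G$ exists. A path decomposition of $G$ is a sequence $(X_i)_{i=1}^\ell$ of subsets of $V(G)$ such that every edge has both endpoints in some $X_i$, and whenever $i<j<k$ and $v\in X_i\cap X_k$ then $v\in X_j$; its width is $\max_i|X_i|-1$ ($0$ if empty); $\mathsf{pw}(G)$ is the minimum width of a path decomposition. -}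

module Defs where

open import Data.Nat using (ℕ; zero; suc; _≤_; _<_; _∸_; _⊔_)
open import Data.Bool using (Bool; true; false; _∧_; _∨_; not)
open import Data.Fin using (Fin; toℕ)
import Data.Fin as F
open import Data.Fin.Subset using (Subset; _∈_; _⊆_; _∪_; ∣_∣; ⊥; ⊤)
open import Data.Vec using (Vec; lookup; tabulate)
open import Data.List using (List; []; _∷_; length; take; foldl; map)
import Data.List as L
open import Data.List.Relation.Unary.All using (All)
open import Data.List.Relation.Unary.Any using (Any)
open import Data.Product using (Σ; _×_; ∃; ∃-syntax)
open import Data.Empty using () renaming (⊥ to Empty)
open import Relation.Binary.PropositionalEquality using (_≡_)
open import Relation.Binary.Construct.Closure.ReflexiveTransitive using (Star)
open import Function.Bundles using (_⇔_)

record Graph (n : ℕ) : Set where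
  field
    adj   : Fin n → Fin n → Bool
    sym   : ∀ u v → adj u v ≡ adj v u
    irrefl : ∀ v → adj v v ≡ false
open Graph public

Edge : ∀ {n} → Graph n → Fin n → Fin n → Set
Edge G u v = adj G u v ≡ true

Connected : ∀ {n} → Graph n → Set
Connected {n} G = (0 < n) × (∀ (u v : Fin n) → Star (Edge G) u v)

anyFin : ∀ {n} → (Fin n → Bool) → Bool
anyFin {zero}  p = false
anyFin {suc n} p = p F.zero ∨ anyFin (λ i → p (F.suc i))

∂ : ∀ {n} → Graph n → Subset n → Subset n
∂ G S = tabulate λ v → lookup S v ∧ anyFin (λ u → adj G v u ∧ not (lookup S u))

_∖_ : ∀ {n} → Subset n → Subset n → Subset n
A ∖ B = tabulate λ v → lookup A v ∧ not (lookup B v)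

-- one step: FC_{t+1} = PC_{t+1} \ ∂(PC_{t+1}), PC_{t+1} = FC_t ∪ S_{t+1}
step : ∀ {n} → Graph n → Subset n → Subset n → Subset n
step G F S = let PC = F ∪ S in PC ∖ ∂ G PC

FC : ∀ {n} → Graph n → List (Subset n) → ℕ → Subset n
FC G S t = foldl (step G) ⊥ (take t S)

IsKSearch : ∀ {n} → ℕ → List (Subset n) → Set
IsKSearch k S = All (λ s → ∣ s ∣ ≤ k) S

Successful : ∀ {n} → Graph n → List (Subset n) → Set
Successful G S = FC G S (length S) ≡ ⊤

Monotonic : ∀ {n} → Graph n → List (Subset n) → Set
Monotonic G S = ∀ i j → i ≤ j → j ≤ length S → FC G S i ⊆ FC G S j

MonSearchable : ∀ {n} → Graph n → ℕ → Set
MonSearchable {n} G k =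
  ∃[ S ] (IsKSearch {n} k S × Successful G S × Monotonic G S)

IsLeast : (ℕ → Set) → ℕ → Set
IsLeast P k = P k × (∀ k′ → P k′ → k ≤ k′)

IsInm : ∀ {n} → Graph n → ℕ → Set
IsInm G = IsLeast (MonSearchable G)

IsPathDecomposition : ∀ {n} → Graph n → List (Subset n) → Set
IsPathDecomposition {n} G X =
  (∀ u v → Edge G u v → Any (λ B → (u ∈ B) × (v ∈ B)) X)
  × (∀ (i j k : Fin (length X)) (v : Fin n) →
       toℕ i < toℕ j → toℕ j < toℕ k →
       v ∈ L.lookup X i → v ∈ L.lookup X k → v ∈ L.lookup X j)

-- width = max |X_i| - 1, and 0 for the empty decomposition
width : ∀ {n} → List (Subset n) → ℕ
width X = L.foldr _⊔_ 0 (map ∣_∣ X) ∸ 1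

HasPDWidth : ∀ {n} → Graph n → ℕ → Set
HasPDWidth G w = ∃[ X ] (IsPathDecomposition G X × width X ≡ w)

IsPw : ∀ {n} → Graph n → ℕ → Set
IsPw G = IsLeast (HasPDWidth G)

-- Searching the bags of a path decomposition X₁ … X_ℓ in order is a monotone search: after
-- step t the cleared set is exactly the interior of X₁ ∪ … ∪ X_t, because by interpolation
-- every boundary vertex of that union also lies in X_{t+1}. Conversely, let e(v) be the step of
-- a successful monotone k-search at which v becomes cleared, and put into bag t every v with
-- t ≤ e(v) having a closed neighbour u with e(u) ≤ t. Such a v is adjacent to (or is) a vertex
-- cleared at step t+1 while v itself is not yet cleared, so it must be searched at step t; the
-- bags therefore have at most k vertices, and they form a path decomposition.
{-# OPTIONS --safe #-}
module Submission where

open import Defs hiding (sym)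
open import Data.Nat using (ℕ; suc)
open import Data.Product using (_×_; ∃-syntax)
open import Relation.Binary.PropositionalEquality using (_≡_)

open import Data.Bool using (Bool; true; false; T; not)
open import Data.Bool.Properties using (T-≡; T-∧; T-∨)
import Data.Bool.Properties as Bool
open import Data.Fin using (Fin; toℕ; fromℕ<)
import Data.Fin as Fin
open import Data.Fin.Properties using (toℕ-fromℕ<; toℕ-injective; toℕ<n; any?; all?; ¬∀⟶∃¬)
open import Data.Fin.Subset using (Subset; _∈_; _∉_; _⊆_; _∪_; ∣_∣; ⊥; ⊤; ⁅_⁆)
open import Data.Fin.Subset.Properties
  using (_∈?_; ∉⊥; ⊥⊆; ∈⊤; ⊆⊤; ⊆-antisym; x∈p∪q⁺; x∈p∪q⁻; ∪-identityˡ; p⊆q⇒∣p∣≤∣q∣; ∣⊤∣≡n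
        ; ∣⁅x⁆∣≡1; x∈⁅x⁆; x∈⁅y⁆⇒x≡y)
open import Data.Nat using (zero; s≤s⁻¹; _≤_; _<_; _∸_; _⊔_; z≤n; s≤s; _≤?_)
open import Data.Nat.Properties
  using (module ≤-Reasoning; ≤-refl; ≤-trans; ≤-antisym; ≤-reflexive; <⇒≤; ≤-total; ≮⇒≥
        ; m≤n⇒m<n∨m≡n; m<n⇒m<1+n; n<1+n; m≤n+m∸n; ⊔-lub; m⊔n≤o⇒m≤o; m⊔n≤o⇒n≤o)
open import Data.Vec using (lookup; tabulate)
open import Data.Vec.Properties using ([]=⇒lookup; lookup⇒[]=; lookup∘tabulate)
open import Data.List using (List; []; _∷_; length; take; foldl; foldr; map; applyUpTo)
import Data.List as List
open import Data.List.Properties using (foldr-forcesᵇ; foldr-preservesᵇ; lookup-applyUpTo)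
open import Data.List.Membership.Propositional.Properties using (∈-lookup)
open import Data.List.Relation.Unary.All using (All; []; _∷_)
import Data.List.Relation.Unary.All as All
import Data.List.Relation.Unary.All.Properties as All
open import Data.List.Relation.Unary.Any using (Any; index)
import Data.List.Relation.Unary.Any as Any
open import Data.List.Relation.Unary.Any.Properties using (lookup-index; applyUpTo⁺)
open import Data.Product using (_,_; proj₁; proj₂; ∃)
open import Data.Sum using (_⊎_; inj₁; inj₂; [_,_]′)
open import Function using (_∘_; id)
open import Function.Bundles using (_⇔_; mk⇔; Equivalence)
open import Relation.Nullary using (¬_; yes; no; contradiction)
open import Relation.Nullary.Decidable using (Dec; isYes; toWitness; fromWitness; _×-dec_; _⊎-dec_)
open import Relation.Unary using (Pred; Decidable)
open import Relation.Binary.Construct.Closure.ReflexiveTransitive using (Star; ε; _◅_)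
open import Relation.Binary.PropositionalEquality using (refl; sym; trans; cong; subst; module ≡-Reasoning)

open Equivalence using (to; from)

private
  variable
    n k t : ℕ

T-not : ∀ {b} → T (not b) ⇔ (¬ T b)
T-not {true}  = mk⇔ (λ ()) (λ h → h _)
T-not {false} = mk⇔ (λ _ ()) (λ _ → _)

T-anyFin : {p : Fin n → Bool} → T (anyFin p) ⇔ ∃ λ u → T (p u)
T-anyFin {zero}      = mk⇔ (λ ()) (λ ())
T-anyFin {suc n} {p} = mk⇔ anyFin⁻ anyFin⁺
  where
  anyFin⁻ : T (anyFin p) → ∃ λ u → T (p u)
  anyFin⁻ h with to T-∨ h
  ... | inj₁ p0 = Fin.zero , p0
  ... | inj₂ ps = let u , pu = to T-anyFin ps in Fin.suc u , pu
  anyFin⁺ : (∃ λ u → T (p u)) → T (anyFin p)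
  anyFin⁺ (Fin.zero  , pu) = from T-∨ (inj₁ pu)
  anyFin⁺ (Fin.suc u , pu) = from T-∨ (inj₂ (from T-anyFin (u , pu)))

∈⇔T : ∀ {p : Subset n} {x} → x ∈ p ⇔ T (lookup p x)
∈⇔T {p = p} {x} = mk⇔ (from T-≡ ∘ []=⇒lookup) (lookup⇒[]= x p ∘ to T-≡)

∈-tabulate : ∀ {f : Fin n → Bool} {x} → x ∈ tabulate f ⇔ T (f x)
∈-tabulate {f = f} {x} = subst (λ b → x ∈ tabulate f ⇔ T b) (lookup∘tabulate f x) ∈⇔T

fromDec : ∀ {ℓ} {P : Pred (Fin n) ℓ} → Decidable P → Subset n
fromDec P? = tabulate (isYes ∘ P?)

∈-fromDec : ∀ {ℓ} {P : Pred (Fin n) ℓ} {P? : Decidable P} {x} → x ∈ fromDec P? ⇔ P x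
∈-fromDec {P? = P?} {x} = mk⇔ (toWitness {a? = P? x} ∘ to ∈-tabulate) (from ∈-tabulate ∘ fromWitness {a? = P? x})

∈-∖ : ∀ {p q : Subset n} {x} → x ∈ p ∖ q ⇔ (x ∈ p × x ∉ q)
∈-∖ = mk⇔
  (λ h → let x∈p , x∉q = to T-∧ (to ∈-tabulate h) in from ∈⇔T x∈p , to T-not x∉q ∘ to ∈⇔T)
  (λ (x∈p , x∉q) → from ∈-tabulate (from T-∧ (to ∈⇔T x∈p , from T-not (x∉q ∘ from ∈⇔T))))

interior : Graph n → Subset n → Subset n
interior G S = S ∖ ∂ G S

ClosedNbr : Graph n → Fin n → Fin n → Set
ClosedNbr G u v = u ≡ v ⊎ Edge G u v

closedNbr? : (G : Graph n) → ∀ u v → Dec (ClosedNbr G u v)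
closedNbr? G u v = u Fin.≟ v ⊎-dec adj G u v Bool.≟ true

module InteriorProperties (G : Graph n) where

  ∈-interior : ∀ {S v} → v ∈ interior G S ⇔ (v ∈ S × v ∉ ∂ G S)
  ∈-interior {S} = ∈-∖ {p = S} {q = ∂ G S}

  ∈-∂ : ∀ {S v} → v ∈ ∂ G S ⇔ (v ∈ S × ∃[ u ] (Edge G v u × u ∉ S))
  ∈-∂ = mk⇔
    (λ h → let v∈S , esc = to T-∧ (to ∈-tabulate h)
               u , vu∧u∉S = to T-anyFin esc
               vu , u∉S = to T-∧ vu∧u∉S
           in from ∈⇔T v∈S , u , to T-≡ vu , to T-not u∉S ∘ to ∈⇔T)
    (λ (v∈S , u , vu , u∉S) →
       from ∈-tabulate (from T-∧ (to ∈⇔T v∈S ,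
         from T-anyFin (u , from T-∧ (from T-≡ vu , from T-not (u∉S ∘ from ∈⇔T))))))

  interior⊆ : ∀ {S} → interior G S ⊆ S
  interior⊆ = proj₁ ∘ to ∈-interior

  ∈-interior⁺ : ∀ {S v} → v ∈ S → (∀ {u} → Edge G v u → u ∈ S) → v ∈ interior G S
  ∈-interior⁺ v∈S nbrs∈S = from ∈-interior (v∈S , λ v∈∂ →
    let _ , _ , vu , u∉S = to ∈-∂ v∈∂ in u∉S (nbrs∈S vu))

  interior-nbr : ∀ {S u v} → v ∈ interior G S → Edge G v u → u ∈ S
  interior-nbr {S} {u} v∈int vu with u ∈? S
  ... | yes u∈S = u∈S
  ... | no  u∉S =
    contradiction (from (∈-∂ {S}) (interior⊆ v∈int , _ , vu , u∉S)) (proj₂ (to (∈-interior {S}) v∈int))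

  interior-closedNbr : ∀ {S u v} → u ∈ interior G S → ClosedNbr G u v → v ∈ S
  interior-closedNbr u∈int (inj₁ refl) = interior⊆ u∈int
  interior-closedNbr u∈int (inj₂ uv)   = interior-nbr u∈int uv

  ∉-interior : ∀ {S v} → v ∈ S → v ∉ interior G S → ∃[ u ] (Edge G v u × u ∉ S)
  ∉-interior {S} {v} v∈S v∉int with v ∈? ∂ G S
  ... | yes v∈∂ = proj₂ (to ∈-∂ v∈∂)
  ... | no  v∉∂ = contradiction (from ∈-interior (v∈S , v∉∂)) v∉int

  interior-mono : ∀ {S S′} → S ⊆ S′ → interior G S ⊆ interior G S′
  interior-mono S⊆S′ v∈int = ∈-interior⁺ (S⊆S′ (interior⊆ v∈int)) (S⊆S′ ∘ interior-nbr v∈int)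

  interior-⊥ : interior G ⊥ ≡ ⊥
  interior-⊥ = ⊆-antisym interior⊆ ⊥⊆

  interior-⊤ : interior G ⊤ ≡ ⊤
  interior-⊤ = ⊆-antisym ⊆⊤ (λ _ → ∈-interior⁺ ∈⊤ (λ _ → ∈⊤))

  interior-∪ : ∀ {A B} → (∀ {v u} → v ∈ A → Edge G v u → u ∉ A → v ∈ B) →
               interior G A ∪ B ≡ A ∪ B
  interior-∪ {A} {B} boundary⊆B = ⊆-antisym ⊆-to ⊆-from
    where
    ⊆-to : interior G A ∪ B ⊆ A ∪ B
    ⊆-to v∈ = x∈p∪q⁺ ([ inj₁ ∘ interior⊆ , inj₂ ]′ (x∈p∪q⁻ _ _ v∈))
    ⊆-from : A ∪ B ⊆ interior G A ∪ B
    ⊆-from {v} v∈ with x∈p∪q⁻ _ _ v∈ | v ∈? interior G A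
    ... | inj₂ v∈B | _           = x∈p∪q⁺ (inj₂ v∈B)
    ... | inj₁ v∈A | yes v∈int   = x∈p∪q⁺ (inj₁ v∈int)
    ... | inj₁ v∈A | no  v∉int   =
      let _ , vu , u∉A = ∉-interior v∈A v∉int in x∈p∪q⁺ (inj₂ (boundary⊆B v∈A vu u∉A))

foldl-take-suc : ∀ {A B : Set} (f : A → B → A) a (xs : List B) (t<ℓ : t < length xs) →
  foldl f a (take (suc t) xs) ≡ f (foldl f a (take t xs)) (List.lookup xs (fromℕ< t<ℓ))
foldl-take-suc {zero}  f a (x ∷ xs) _         = refl
foldl-take-suc {suc t} f a (x ∷ xs) (s≤s t<ℓ) = foldl-take-suc f (f a x) xs t<ℓ

module _ {x : Fin n} where

  ∈-foldl-∪-take⁻ : ∀ p (xs : List (Subset n)) t → x ∈ foldl _∪_ p (take t xs) →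
                    x ∈ p ⊎ ∃[ i ] (toℕ i < t × x ∈ List.lookup xs i)
  ∈-foldl-∪-take⁻ p xs       zero    x∈ = inj₁ x∈
  ∈-foldl-∪-take⁻ p []       (suc t) x∈ = inj₁ x∈
  ∈-foldl-∪-take⁻ p (y ∷ ys) (suc t) x∈ with ∈-foldl-∪-take⁻ (p ∪ y) ys t x∈
  ... | inj₂ (i , i<t , x∈yᵢ) = inj₂ (Fin.suc i , s≤s i<t , x∈yᵢ)
  ... | inj₁ x∈p∪y with x∈p∪q⁻ p y x∈p∪y
  ...   | inj₁ x∈p = inj₁ x∈p
  ...   | inj₂ x∈y = inj₂ (Fin.zero , s≤s z≤n , x∈y)

  ∈-foldl-∪-take⁺ : ∀ p (xs : List (Subset n)) t →
                    x ∈ p ⊎ ∃[ i ] (toℕ i < t × x ∈ List.lookup xs i) → x ∈ foldl _∪_ p (take t xs)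
  ∈-foldl-∪-take⁺ p xs       zero    (inj₁ x∈p) = x∈p
  ∈-foldl-∪-take⁺ p []       (suc t) (inj₁ x∈p) = x∈p
  ∈-foldl-∪-take⁺ p (y ∷ ys) (suc t) (inj₁ x∈p) =
    ∈-foldl-∪-take⁺ (p ∪ y) ys t (inj₁ (x∈p∪q⁺ (inj₁ x∈p)))
  ∈-foldl-∪-take⁺ p (y ∷ ys) (suc t) (inj₂ (Fin.zero , _ , x∈y)) =
    ∈-foldl-∪-take⁺ (p ∪ y) ys t (inj₁ (x∈p∪q⁺ (inj₂ x∈y)))
  ∈-foldl-∪-take⁺ p (y ∷ ys) (suc t) (inj₂ (Fin.suc i , s≤s i<t , x∈yᵢ)) =
    ∈-foldl-∪-take⁺ (p ∪ y) ys t (inj₂ (i , i<t , x∈yᵢ))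

crossing : ∀ {ℓ} {P : ℕ → Set} → Decidable P → ¬ P 0 → P ℓ → ∃[ e ] (e < ℓ × ¬ P e × P (suc e))
crossing {zero}  P? ¬P₀ Pℓ = contradiction Pℓ ¬P₀
crossing {suc ℓ} P? ¬P₀ Pℓ₊₁ with P? ℓ
... | yes Pℓ = let e , e<ℓ , rest = crossing P? ¬P₀ Pℓ in e , m<n⇒m<1+n e<ℓ , rest
... | no ¬Pℓ = ℓ , n<1+n ℓ , ¬Pℓ , Pℓ₊₁

maxSize : List (Subset n) → ℕ
maxSize X = foldr _⊔_ 0 (map ∣_∣ X)

size≤maxSize : (X : List (Subset n)) → All (λ s → ∣ s ∣ ≤ maxSize X) X
size≤maxSize X = All.map⁻ (foldr-forcesᵇ (λ a b a⊔b≤ → m⊔n≤o⇒m≤o a b a⊔b≤ , m⊔n≤o⇒n≤o a b a⊔b≤)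
                                         0 (map ∣_∣ X) ≤-refl)

maxSize-lub : {X : List (Subset n)} → All (λ s → ∣ s ∣ ≤ k) X → maxSize X ≤ k
maxSize-lub {k = k} = foldr-preservesᵇ {P = _≤ k} ⊔-lub z≤n ∘ All.map⁺

x∈p⇒0<∣p∣ : ∀ {p : Subset n} {x} → x ∈ p → 0 < ∣ p ∣
x∈p⇒0<∣p∣ {p = p} {x} x∈p =
  subst (_≤ ∣ p ∣) (∣⁅x⁆∣≡1 x) (p⊆q⇒∣p∣≤∣q∣ (λ y∈⁅x⁆ → subst (_∈ p) (sym (x∈⁅y⁆⇒x≡y x y∈⁅x⁆)) x∈p))

module SearchProperties (G : Graph n) where

  open InteriorProperties G

  FC-suc : (S : List (Subset n)) (t<ℓ : t < length S) →
           FC G S (suc t) ≡ interior G (FC G S t ∪ List.lookup S (fromℕ< t<ℓ))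
  FC-suc = foldl-take-suc (step G) ⊥

  monotonic-[_] : ∀ s → Monotonic G (s ∷ [])
  monotonic-[ s ] zero    _       _         _         = ⊥⊆
  monotonic-[ s ] (suc _) (suc _) (s≤s z≤n) (s≤s z≤n) = id

  ⊤-search : MonSearchable G n
  ⊤-search = ⊤ {n} ∷ [] , ≤-reflexive (∣⊤∣≡n n) ∷ []
           , trans (cong (interior G) (∪-identityˡ (⊤ {n}))) interior-⊤ , monotonic-[ ⊤ ]

  monSearchable-mono : ∀ {k k′} → k ≤ k′ → MonSearchable G k → MonSearchable G k′
  monSearchable-mono k≤k′ (S , S-k , S-succ , S-mono) =
    S , All.map (λ s≤k → ≤-trans s≤k k≤k′) S-k , S-succ , S-mono

  isolated⇒n≤1 : Connected G → ∀ {v} → (∀ {u} → ¬ Edge G v u) → n ≤ 1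
  isolated⇒n≤1 (_ , walk) {v} isolated = begin
      n          ≡⟨ sym (∣⊤∣≡n n) ⟩
      ∣ ⊤ {n} ∣  ≤⟨ p⊆q⇒∣p∣≤∣q∣ {p = ⊤} (λ {u} _ → subst (_∈ ⁅ v ⁆) (only-v u (walk v u)) (x∈⁅x⁆ v)) ⟩
      ∣ ⁅ v ⁆ ∣  ≡⟨ ∣⁅x⁆∣≡1 v ⟩
      1          ∎
    where
    open ≤-Reasoning
    only-v : ∀ u → Star (Edge G) v u → v ≡ u
    only-v u ε        = refl
    only-v u (vw ◅ _) = contradiction vw isolated

module DecompositionToSearch {G : Graph n} {X : List (Subset n)} (X-pd : IsPathDecomposition G X) where

  open InteriorProperties G
  open SearchProperties G

  private
    ℓ = length X
    covers = proj₁ X-pd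
    interpolates = proj₂ X-pd

  Covered : ℕ → Subset n
  Covered t = foldl _∪_ ⊥ (take t X)

  ∈-Covered⁻ : ∀ {v} → v ∈ Covered t → ∃[ i ] (toℕ i < t × v ∈ List.lookup X i)
  ∈-Covered⁻ v∈ = [ (λ v∈⊥ → contradiction v∈⊥ ∉⊥) , id ]′ (∈-foldl-∪-take⁻ ⊥ X _ v∈)

  ∈-Covered⁺ : ∀ {v} (i : Fin ℓ) → toℕ i < t → v ∈ List.lookup X i → v ∈ Covered t
  ∈-Covered⁺ i i<t v∈Xᵢ = ∈-foldl-∪-take⁺ ⊥ X _ (inj₂ (i , i<t , v∈Xᵢ))

  Covered-mono : ∀ {s} → s ≤ t → Covered s ⊆ Covered t
  Covered-mono s≤t v∈ = let i , i<s , v∈Xᵢ = ∈-Covered⁻ v∈ in ∈-Covered⁺ i (≤-trans i<s s≤t) v∈Xᵢ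

  boundary⊆bag : ∀ {u v} (t<ℓ : t < ℓ) → v ∈ Covered t → Edge G v u → u ∉ Covered t →
                 v ∈ List.lookup X (fromℕ< t<ℓ)
  boundary⊆bag {t} {u} {v} t<ℓ v∈ vu u∉ = in-bag (∈-Covered⁻ v∈) (m≤n⇒m<n∨m≡n t≤j)
    where
    edge-bag = covers v u vu
    j = index edge-bag
    v∈Xⱼ = proj₁ (lookup-index edge-bag)
    t≤j : t ≤ toℕ j
    t≤j = ≮⇒≥ (λ j<t → u∉ (∈-Covered⁺ j j<t (proj₂ (lookup-index edge-bag))))
    tᶠ = fromℕ< t<ℓ
    in-bag : ∃[ i ] (toℕ i < t × v ∈ List.lookup X i) → t < toℕ j ⊎ t ≡ toℕ j → v ∈ List.lookup X tᶠ
    in-bag (i , i<t , v∈Xᵢ) (inj₁ t<j) =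
      interpolates i tᶠ j v (subst (toℕ i <_) (sym (toℕ-fromℕ< t<ℓ)) i<t)
                            (subst (_< toℕ j) (sym (toℕ-fromℕ< t<ℓ)) t<j) v∈Xᵢ v∈Xⱼ
    in-bag _ (inj₂ t≡j) =
      subst (λ b → v ∈ List.lookup X b) (toℕ-injective (sym (trans (toℕ-fromℕ< t<ℓ) t≡j))) v∈Xⱼ

  FC≡interior-Covered : t ≤ ℓ → FC G X t ≡ interior G (Covered t)
  FC≡interior-Covered {zero}  _      = sym interior-⊥
  FC≡interior-Covered {suc t} t<ℓ = begin
    FC G X (suc t)                            ≡⟨ FC-suc X t<ℓ ⟩
    interior G (FC G X t ∪ Xₜ)                ≡⟨ cong (λ F → interior G (F ∪ Xₜ)) (FC≡interior-Covered (<⇒≤ t<ℓ)) ⟩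
    interior G (interior G (Covered t) ∪ Xₜ)  ≡⟨ cong (interior G) (interior-∪ (boundary⊆bag t<ℓ)) ⟩
    interior G (Covered t ∪ Xₜ)               ≡⟨ cong (interior G) (sym (foldl-take-suc _∪_ ⊥ X t<ℓ)) ⟩
    interior G (Covered (suc t))              ∎
    where
    open ≡-Reasoning
    Xₜ = List.lookup X (fromℕ< t<ℓ)

  monotonic : Monotonic G X
  monotonic i j i≤j j≤ℓ rewrite FC≡interior-Covered (≤-trans i≤j j≤ℓ) | FC≡interior-Covered j≤ℓ =
    interior-mono (Covered-mono i≤j)

  search : Connected G → MonSearchable G (suc (width X))
  search G-conn with all? (_∈? Covered ℓ)
  ... | yes all-covered = X , bounded , successful , monotonic
    where
    bounded : IsKSearch (suc (width X)) X
    bounded = All.map (λ s≤max → ≤-trans s≤max (m≤n+m∸n (maxSize X) 1)) (size≤maxSize X)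
    successful : Successful G X
    successful = begin
      FC G X ℓ                ≡⟨ FC≡interior-Covered ≤-refl ⟩
      interior G (Covered ℓ)  ≡⟨ cong (interior G) (⊆-antisym ⊆⊤ (λ {v} _ → all-covered v)) ⟩
      interior G ⊤            ≡⟨ interior-⊤ ⟩
      ⊤                       ∎
      where open ≡-Reasoning
  -- A vertex lying in no bag has no neighbours, so by connectedness it is the only vertex.
  ... | no ¬all-covered =
    let v , v∉ = ¬∀⟶∃¬ n _ (_∈? Covered ℓ) ¬all-covered
        isolated : ∀ {u} → ¬ Edge G v u
        isolated vu = let edge-bag = covers v _ vu in
          v∉ (∈-Covered⁺ (index edge-bag) (toℕ<n _) (proj₁ (lookup-index edge-bag)))
    in monSearchable-mono (≤-trans (isolated⇒n≤1 G-conn isolated) (s≤s z≤n)) ⊤-search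

module SearchToDecomposition {G : Graph n} {S : List (Subset n)}
  (S-k : IsKSearch k S) (S-succ : Successful G S) (S-mono : Monotonic G S) where

  open InteriorProperties G
  open SearchProperties G

  private
    ℓ = length S

  clearing : ∀ v → ∃[ e ] (e < ℓ × v ∉ FC G S e × v ∈ FC G S (suc e))
  clearing v = crossing (λ t → v ∈? FC G S t) ∉⊥ (subst (v ∈_) (sym S-succ) ∈⊤)

  clearingTime : Fin n → ℕ
  clearingTime v = proj₁ (clearing v)

  clearingTime<ℓ : ∀ v → clearingTime v < ℓ
  clearingTime<ℓ v = proj₁ (proj₂ (clearing v))

  cleared-after : ∀ {v} → clearingTime v < t → t ≤ ℓ → v ∈ FC G S t
  cleared-after {v = v} e<t t≤ℓ = S-mono _ _ e<t t≤ℓ (proj₂ (proj₂ (proj₂ (clearing v))))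

  uncleared-until : ∀ {v} → t ≤ clearingTime v → v ∉ FC G S t
  uncleared-until {v = v} t≤e v∈ =
    proj₁ (proj₂ (proj₂ (clearing v))) (S-mono _ _ t≤e (<⇒≤ (clearingTime<ℓ v)) v∈)

  InBag : ℕ → Fin n → Set
  InBag t v = t ≤ clearingTime v × ∃[ u ] (ClosedNbr G u v × clearingTime u ≤ t)

  inBag? : ∀ t v → Dec (InBag t v)
  inBag? t v = t ≤? clearingTime v ×-dec any? λ u → closedNbr? G u v ×-dec clearingTime u ≤? t

  bag : ℕ → Subset n
  bag t = fromDec (inBag? t)

  bag⊆search : (t<ℓ : t < ℓ) → bag t ⊆ List.lookup S (fromℕ< t<ℓ)
  bag⊆search t<ℓ v∈bag =
    let t≤eᵥ , u , u~v , eᵤ≤t = to ∈-fromDec v∈bag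
        u∈FC = subst (u ∈_) (FC-suc S t<ℓ) (cleared-after {v = u} (s≤s eᵤ≤t) t<ℓ)
    in [ (λ v∈FC → contradiction v∈FC (uncleared-until t≤eᵥ)) , id ]′
         (x∈p∪q⁻ _ _ (interior-closedNbr u∈FC u~v))

  bags : List (Subset n)
  bags = applyUpTo bag ℓ

  bags-lookup : ∀ i → List.lookup bags i ≡ bag (toℕ i)
  bags-lookup = lookup-applyUpTo bag ℓ

  edge-in-bag : ∀ {u v} → ClosedNbr G u v → clearingTime u ≤ clearingTime v →
                Any (λ b → u ∈ b × v ∈ b) bags
  edge-in-bag {u} u~v eᵤ≤eᵥ =
    applyUpTo⁺ bag (from ∈-fromDec (≤-refl , u , inj₁ refl , ≤-refl) , from ∈-fromDec (eᵤ≤eᵥ , u , u~v , ≤-refl))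
                   (clearingTime<ℓ u)

  bag-convex : ∀ {r s v} → r ≤ s → s ≤ t → v ∈ bag r → v ∈ bag t → v ∈ bag s
  bag-convex r≤s s≤t v∈bagᵣ v∈bagₜ =
    let _ , u , u~v , eᵤ≤r = to ∈-fromDec v∈bagᵣ
        t≤eᵥ , _ = to ∈-fromDec v∈bagₜ
    in from ∈-fromDec (≤-trans s≤t t≤eᵥ , u , u~v , ≤-trans eᵤ≤r r≤s)

  bags-decomposition : IsPathDecomposition G bags
  bags-decomposition = covers , interpolates
    where
    covers : ∀ u v → Edge G u v → Any (λ b → u ∈ b × v ∈ b) bags
    covers u v uv with ≤-total (clearingTime u) (clearingTime v)
    ... | inj₁ eᵤ≤eᵥ = edge-in-bag (inj₂ uv) eᵤ≤eᵥ
    ... | inj₂ eᵥ≤eᵤ = Any.map (λ (v∈b , u∈b) → u∈b , v∈b)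
                         (edge-in-bag (inj₂ (trans (Graph.sym G v u) uv)) eᵥ≤eᵤ)
    interpolates : ∀ (i j k : Fin (length bags)) v → toℕ i < toℕ j → toℕ j < toℕ k →
                   v ∈ List.lookup bags i → v ∈ List.lookup bags k → v ∈ List.lookup bags j
    interpolates i j k v i<j j<k v∈bᵢ v∈bₖ =
      subst (v ∈_) (sym (bags-lookup j))
        (bag-convex (<⇒≤ i<j) (<⇒≤ j<k) (subst (v ∈_) (bags-lookup i) v∈bᵢ)
                                         (subst (v ∈_) (bags-lookup k) v∈bₖ))

  search-size : (t<ℓ : t < ℓ) → ∣ List.lookup S (fromℕ< t<ℓ) ∣ ≤ k
  search-size t<ℓ = All.lookup S-k (∈-lookup (fromℕ< t<ℓ))

  bag-size : All (λ b → ∣ b ∣ ≤ k) bags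
  bag-size = All.applyUpTo⁺₁ bag ℓ λ t<ℓ → ≤-trans (p⊆q⇒∣p∣≤∣q∣ (bag⊆search t<ℓ)) (search-size t<ℓ)

  decomposition : Fin n → ∃[ w ] (HasPDWidth G w × suc w ≤ k)
  decomposition v = width bags , (bags , bags-decomposition , refl) , suc-pred≤ (maxSize-lub bag-size)
    where
    eᵥ<ℓ = clearingTime<ℓ v
    1≤k : 1 ≤ k
    1≤k = ≤-trans (x∈p⇒0<∣p∣ (bag⊆search eᵥ<ℓ (from ∈-fromDec (≤-refl , v , inj₁ refl , ≤-refl))))
                  (search-size eᵥ<ℓ)
    -- `width` truncates at 0 when every bag is empty, hence the need for k ≥ 1.
    suc-pred≤ : ∀ {m} → m ≤ k → suc (m ∸ 1) ≤ k
    suc-pred≤ {zero}  _   = 1≤k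
    suc-pred≤ {suc m} m≤k = m≤k

least-shift : {P Q : ℕ → Set} → (∀ {w} → P w → Q (suc w)) → (∀ {k} → Q k → ∃[ w ] (P w × suc w ≤ k)) →
              (∀ p → IsLeast P p → IsLeast Q (suc p)) × (∀ k → IsLeast Q k → ∃[ p ] (k ≡ suc p × IsLeast P p))
least-shift {P} {Q} P⇒Q Q⇒P = least-P⇒least-Q , least-Q⇒least-P
  where
  least-P⇒least-Q : ∀ p → IsLeast P p → IsLeast Q (suc p)
  least-P⇒least-Q p (Pp , p-min) = P⇒Q Pp , λ k Qk →
    let w , Pw , w<k = Q⇒P Qk in ≤-trans (s≤s (p-min w Pw)) w<k
  least-Q⇒least-P : ∀ k → IsLeast Q k → ∃[ p ] (k ≡ suc p × IsLeast P p)
  least-Q⇒least-P k (Qk , k-min) =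
    let w , Pw , w<k = Q⇒P Qk in
    w , ≤-antisym (k-min (suc w) (P⇒Q Pw)) w<k
      , Pw , λ w′ Pw′ → s≤s⁻¹ (≤-trans w<k (k-min (suc w′) (P⇒Q Pw′)))

theorem4p5 : ∀ {n} (G : Graph n) → Connected G →
    (∀ p → IsPw G p → IsInm G (suc p)) × (∀ k → IsInm G k → ∃[ p ] (k ≡ suc p × IsPw G p))
theorem4p5 G G-conn = least-shift decomposition⇒search search⇒decomposition
  where
  decomposition⇒search : ∀ {w} → HasPDWidth G w → MonSearchable G (suc w)
  decomposition⇒search (X , X-pd , refl) = DecompositionToSearch.search {G = G} X-pd G-conn
  search⇒decomposition : ∀ {k} → MonSearchable G k → ∃[ w ] (HasPDWidth G w × suc w ≤ k)
  search⇒decomposition (S , S-k , S-succ , S-mono) =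
    SearchToDecomposition.decomposition {G = G} S-k S-succ S-mono (fromℕ< (proj₁ G-conn))
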